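{- Let $n$ be even, let $A$ be an abelian group of order $n$ that is not an elementary abelian $2$-group, and let $G=D(A)=\langle x,A\mid x^2=1,\ xax=a^{ -1}\ \forall a\in A\rangle$ act on the $n$ left cosets of $H=\langle x\rangle$, so $G\le\mathrm{Sym}(n)$. Suppose that $A\not\le\mathrm{Alt}(n)$ (some element of $A$ acts as an odd permutation). Then there is no inverse-closed $C\subseteq\mathrm{Der}(G)$ such that $\alpha(\Gamma_G)<\alpha(\mathrm{Cay}(G,C))<2\alpha(\Gamma_G)$.
   Context: A derangement is an element fixing no coset; $\mathrm{Der}(G)$ is the set of derangements. For inverse-closed $S\subseteq G$ not containing the identity, $\mathrm{Cay}(G,S)$ is the graph on $G$ with $g,h$ adjacent iff $g^{ -1}h\in S$; $\Gamma_G=\mathrm{Cay}(G,\mathrm{Der}(G))$; $\alpha$ denotes independence number. -}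

module Defs where

open import Data.Nat using (ℕ; _≤_; _%_)
open import Data.Fin using (Fin; _<?_)
open import Data.Bool using (Bool; true; false; if_then_else_; _xor_)
open import Data.Product using (_×_; _,_; ∃; proj₁; proj₂)
open import Data.Sum using (_⊎_)
open import Data.List using (List; length; filter; allFin; cartesianProduct)
open import Data.List.Relation.Unary.Unique.Propositional using (Unique)
open import Data.List.Membership.Propositional using (_∈_)
open import Relation.Nullary using (¬_)
open import Relation.Nullary.Decidable using (_×-dec_)
open import Relation.Binary.PropositionalEquality using (_≡_)

inversions : ∀ {m} → (Fin m → Fin m) → ℕ
inversions {m} σ =
  length (filter (λ p → (proj₁ p <? proj₂ p) ×-dec (σ (proj₂ p) <? σ (proj₁ p)))
                 (cartesianProduct (allFin m) (allFin m)))

IsOddPerm : ∀ {m} → (Fin m → Fin m) → Set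
IsOddPerm σ = inversions σ % 2 ≡ 1

-- The generalized dihedral group D(A) = A ⋊ ⟨x⟩ for an abelian group
-- A with carrier Fin n.  The element (s , a) stands for x^s a.
module Dihedral {n : ℕ} (_∙_ : Fin n → Fin n → Fin n) (ε : Fin n) (_⁻¹ : Fin n → Fin n) where

  G : Set
  G = Bool × Fin n

  -- x^s a · x^t b = x^(s+t) a^((-1)^t) b   (since a x = x a⁻¹)
  _·_ : G → G → G
  (s , a) · (t , b) = (s xor t , (if t then a ⁻¹ else a) ∙ b)

  inv : G → G
  inv (false , a) = (false , a ⁻¹)
  inv (true , a) = (true , a)

  1G : G
  1G = (false , ε)

  x : G
  x = (true , ε)

  InH : G → Set
  InH g = g ≡ 1G ⊎ g ≡ x

  FixesCoset : G → G → Set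
  FixesCoset g k = ∃ λ h → InH h × (g · k ≡ k · h)

  Derangement : G → Set
  Derangement g = ∀ k → ¬ FixesCoset g k

  InverseClosed : (G → Set) → Set
  InverseClosed S = ∀ g → S g → S (inv g)

  -- independent sets of Cay(G,S), as duplicate-free lists of vertices
  Independent : (G → Set) → List G → Set
  Independent S I = Unique I × (∀ g h → g ∈ I → h ∈ I → ¬ S (inv g · h))

  IsIndependenceNumber : (G → Set) → ℕ → Set
  IsIndependenceNumber S k =
    (∃ λ I → Independent S I × length I ≡ k) × (∀ I → Independent S I → length I ≤ k)

  -- Labelling of the n left cosets of H by A: the coset aH (a ∈ A) gets label a.
  -- The coset of x a is {x a, a⁻¹}, i.e. a⁻¹H.
  cosetLabel : G → Fin n
  cosetLabel (false , a) = a
  cosetLabel (true , a) = a ⁻¹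

  cosetAction : G → Fin n → Fin n
  cosetAction g a = cosetLabel (g · (false , a))

-- Let K be the subgroup of squares of A.  The sign of the translation a ↦ c a is a
-- homomorphism A → ℤ/2 vanishing on K.  Translation by c is the product of the
-- reflections a ↦ a⁻¹ and a ↦ c a⁻¹; for c ∉ K the latter is a fixed-point-free
-- involution, and all of these have the same sign (n/2 transpositions), so all
-- non-squares have the same sign.  Some translation is odd, hence every non-square is
-- odd and a product of two non-squares is a square: K has index two in A.
--
-- Hence g ↦ (g is a reflection, the A-part of g is a non-square) is a homomorphism
-- G → (ℤ/2)², and the non-derangements of G are 1 and the reflections in x K.  So
-- α(Γ_G) = 2: {1, x} is independent, and three pairwise differences cannot all be
-- reflections.  It remains to rule out α(Cay(G, C)) = 3.  Two points g, g p of an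
-- independent triple of Cay(G, C) differ by a non-trivial rotation p, and either
-- p ∈ K (put q = x) or, after relabelling, the third point is g q with q ∈ x K.  In
-- both cases {g, g p, g q, g q p} is independent, because q p = p⁻¹ q.

module Submission where

open import Algebra.Bundles using (AbelianGroup; CommutativeRing; Group)
import Algebra.Properties.AbelianGroup as AbelianGroupProperties
import Algebra.Properties.CommutativeMonoid.Sum as CommutativeMonoidSum
import Algebra.Properties.CommutativeSemigroup as CommutativeSemigroupProperties
import Algebra.Properties.Group as GroupProperties
open import Algebra.Structures using (IsAbelianGroup)
open import Data.Bool as Bool using (Bool; true; false; not; _∧_; _xor_; if_then_else_)
open import Data.Bool.Properties
  using ( xor-∧-commutativeRing; xor-same; xor-identityʳ; xor-assoc; xor-annihilates-not; not-distribˡ-xor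
        ; ∧-distribˡ-xor; ∧-comm; ∧-idem; not-¬; ¬-not; not-involutive)
open import Data.Empty using (⊥)
open import Data.Fin as Fin using (Fin; zero; suc; _<?_; _≟_)
open import Data.Fin.Permutation as Permutation using (Permutation′; _⟨$⟩ʳ_; _⟨$⟩ˡ_; _∘ₚ_; flip; permutation)
open import Data.Fin.Properties using (<-cmp; <-irrefl; any?)
open import Data.List using (List; []; _∷_; length; filter; tabulate; allFin; cartesianProduct; map; _++_; foldr)
open import Data.List.Membership.Propositional using (_∈_)
open import Data.List.Properties using (foldr-map)
open import Data.List.Relation.Unary.All as All using ([]; _∷_)
open import Data.List.Relation.Unary.AllPairs as AllPairs using (AllPairs; []; _∷_)
import Data.List.Relation.Unary.AllPairs.Properties as AllPairs
open import Data.List.Relation.Unary.Any using (here; there)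
open import Data.Nat using (ℕ; zero; suc; _+_; _*_; _%_; _≤_; _<_; z≤n; s≤s)
open import Data.Nat.Divisibility using (_∣_)
open import Data.Nat.Properties
  using (+-0-commutativeMonoid; +-suc; +-identityʳ; *-cancelˡ-≡; ≤-trans; <-≤-trans; *-monoʳ-≤; ≤⇒≯)
open import Data.Product using (∃; _×_; _,_; proj₁; proj₂)
open import Data.Sum using (_⊎_; inj₁; inj₂)
open import Defs
open import Function using (_∘_; id)
open import Level using (0ℓ)
open import Relation.Binary using (tri<; tri≈; tri>)
open import Relation.Binary.PropositionalEquality
open import Relation.Nullary using (¬_; does; yes; no; contradiction)
open import Relation.Nullary.Decidable using (dec-true; dec-false; _×-dec_; decidable-stable)
open import Relation.Unary using (Pred; Decidable)

module XorSum = CommutativeMonoidSum (CommutativeRing.+-commutativeMonoid xor-∧-commutativeRing)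
module NatSum = CommutativeMonoidSum +-0-commutativeMonoid
open XorSum using (sum-syntax; sum-cong-≗; ∑-distrib-+; ∑-permute)

-- Parity and xor-sums

oddᵇ : ℕ → Bool
oddᵇ zero = false
oddᵇ (suc zero) = true
oddᵇ (suc (suc n)) = oddᵇ n

oddᵇ-suc : ∀ n → oddᵇ (suc n) ≡ not (oddᵇ n)
oddᵇ-suc zero = refl
oddᵇ-suc (suc zero) = refl
oddᵇ-suc (suc (suc n)) = oddᵇ-suc n

oddᵇ-+ : ∀ m n → oddᵇ (m + n) ≡ oddᵇ m xor oddᵇ n
oddᵇ-+ zero n = refl
oddᵇ-+ (suc m) n = begin
  oddᵇ (suc (m + n))       ≡⟨ oddᵇ-suc (m + n) ⟩
  not (oddᵇ (m + n))       ≡⟨ cong not (oddᵇ-+ m n) ⟩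
  not (oddᵇ m xor oddᵇ n)  ≡⟨ not-distribˡ-xor (oddᵇ m) (oddᵇ n) ⟩
  not (oddᵇ m) xor oddᵇ n  ≡⟨ cong (_xor oddᵇ n) (oddᵇ-suc m) ⟨
  oddᵇ (suc m) xor oddᵇ n  ∎
  where open ≡-Reasoning

oddᵇ-%2 : ∀ n → n % 2 ≡ 1 → oddᵇ n ≡ true
oddᵇ-%2 (suc zero) _ = refl
oddᵇ-%2 (suc (suc n)) n%2≡1 = oddᵇ-%2 n n%2≡1

xor-cancelˡ : ∀ a b → a xor (a xor b) ≡ b
xor-cancelˡ false b = refl
xor-cancelˡ true b = not-involutive b

xor-cancel-middle : ∀ a b c → (a xor b) xor (b xor c) ≡ a xor c
xor-cancel-middle false false c = refl
xor-cancel-middle false true false = refl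
xor-cancel-middle false true true = refl
xor-cancel-middle true false c = refl
xor-cancel-middle true true c = refl

∧-not≡∧-xor : ∀ a b → a ∧ not b ≡ a ∧ (a xor b)
∧-not≡∧-xor false b = refl
∧-not≡∧-xor true b = refl

≢-≢⇒≡ : ∀ {a b c : Bool} → a ≢ b → a ≢ c → b ≡ c
≢-≢⇒≡ a≢b a≢c = trans (¬-not (a≢b ∘ sym)) (sym (¬-not (a≢c ∘ sym)))

⊕ˡ : {A : Set} → (A → Bool) → List A → Bool
⊕ˡ f = foldr (λ x b → f x xor b) false

oddᵇ-length-filter : {A : Set} {P : Pred A 0ℓ} (P? : Decidable P) (xs : List A) →
                     oddᵇ (length (filter P? xs)) ≡ ⊕ˡ (does ∘ P?) xs
oddᵇ-length-filter P? [] = refl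
oddᵇ-length-filter P? (x ∷ xs) with does (P? x)
... | false = oddᵇ-length-filter P? xs
... | true = trans (oddᵇ-suc (length (filter P? xs))) (cong not (oddᵇ-length-filter P? xs))

⊕ˡ-++ : {A : Set} (f : A → Bool) (xs ys : List A) → ⊕ˡ f (xs ++ ys) ≡ ⊕ˡ f xs xor ⊕ˡ f ys
⊕ˡ-++ f [] ys = refl
⊕ˡ-++ f (x ∷ xs) ys = trans (cong (f x xor_) (⊕ˡ-++ f xs ys)) (sym (xor-assoc (f x) _ _))

⊕ˡ-tabulate : ∀ {k} {A : Set} (f : A → Bool) (g : Fin k → A) → ⊕ˡ f (tabulate g) ≡ ∑[ i < k ] f (g i)
⊕ˡ-tabulate {zero} f g = refl
⊕ˡ-tabulate {suc k} f g = cong (f (g zero) xor_) (⊕ˡ-tabulate f (g ∘ suc))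

⊕ˡ-cartesianProduct : ∀ {k} {A B : Set} (f : A × B → Bool) (g : Fin k → A) (ys : List B) →
  ⊕ˡ f (cartesianProduct (tabulate g) ys) ≡ ∑[ i < k ] ⊕ˡ (λ y → f (g i , y)) ys
⊕ˡ-cartesianProduct {zero} f g ys = refl
⊕ˡ-cartesianProduct {suc k} f g ys = begin
  ⊕ˡ f (map (g zero ,_) ys ++ cartesianProduct (tabulate (g ∘ suc)) ys)
    ≡⟨ ⊕ˡ-++ f (map (g zero ,_) ys) _ ⟩
  ⊕ˡ f (map (g zero ,_) ys) xor ⊕ˡ f (cartesianProduct (tabulate (g ∘ suc)) ys)
    ≡⟨ cong₂ _xor_ (foldr-map _ (g zero ,_) false ys) (⊕ˡ-cartesianProduct f (g ∘ suc) ys) ⟩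
  ⊕ˡ (λ y → f (g zero , y)) ys xor ∑[ i < k ] ⊕ˡ (λ y → f (g (suc i) , y)) ys ∎
  where open ≡-Reasoning

module _ {k : ℕ} where

  ∑∑-cong : {f g : Fin k → Fin k → Bool} → (∀ i j → f i j ≡ g i j) →
            ∑[ i < k ] ∑[ j < k ] f i j ≡ ∑[ i < k ] ∑[ j < k ] g i j
  ∑∑-cong f≡g = sum-cong-≗ (λ i → sum-cong-≗ (f≡g i))

  ∑∑-distrib-xor : (f g : Fin k → Fin k → Bool) →
    ∑[ i < k ] ∑[ j < k ] (f i j xor g i j) ≡ (∑[ i < k ] ∑[ j < k ] f i j) xor (∑[ i < k ] ∑[ j < k ] g i j)
  ∑∑-distrib-xor f g =
    trans (sum-cong-≗ (λ i → ∑-distrib-+ (f i) (g i)))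
          (∑-distrib-+ (λ i → ∑[ j < k ] f i j) (λ i → ∑[ j < k ] g i j))

  ∑-reindex : (π : Permutation′ k) (f : Fin k → Bool) → ∑[ i < k ] f (π ⟨$⟩ʳ i) ≡ ∑[ i < k ] f i
  ∑-reindex π f = sym (∑-permute f π)

  ∑∑-reindex : (π : Permutation′ k) (f : Fin k → Fin k → Bool) →
    ∑[ i < k ] ∑[ j < k ] f (π ⟨$⟩ʳ i) (π ⟨$⟩ʳ j) ≡ ∑[ i < k ] ∑[ j < k ] f i j
  ∑∑-reindex π f = trans (∑-reindex π (λ a → ∑[ j < k ] f a (π ⟨$⟩ʳ j))) (sum-cong-≗ (λ i → ∑-reindex π (f i)))

∑∑-symmetric≡trace : ∀ {k} (E : Fin k → Fin k → Bool) → (∀ i j → E i j ≡ E j i) →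
                     ∑[ i < k ] ∑[ j < k ] E i j ≡ ∑[ i < k ] E i i
∑∑-symmetric≡trace {zero} E E-sym = refl
∑∑-symmetric≡trace {suc k} E E-sym = begin
  (E₀₀ xor row₀) xor ∑[ i < k ] (E (suc i) zero xor ∑[ j < k ] E (suc i) (suc j))
    ≡⟨ cong ((E₀₀ xor row₀) xor_) (∑-distrib-+ (λ i → E (suc i) zero) _) ⟩
  (E₀₀ xor row₀) xor (∑[ i < k ] E (suc i) zero xor ∑[ i < k ] ∑[ j < k ] E (suc i) (suc j))
    ≡⟨ cong₂ (λ a b → (E₀₀ xor row₀) xor (a xor b))
             (sum-cong-≗ (λ i → E-sym (suc i) zero))
             (∑∑-symmetric≡trace (λ i j → E (suc i) (suc j)) (λ i j → E-sym (suc i) (suc j))) ⟩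
  (E₀₀ xor row₀) xor (row₀ xor ∑[ i < k ] E (suc i) (suc i))
    ≡⟨ xor-cancel-middle E₀₀ row₀ _ ⟩
  E₀₀ xor ∑[ i < k ] E (suc i) (suc i) ∎
  where
  open ≡-Reasoning
  E₀₀ = E zero zero
  row₀ = ∑[ j < k ] E zero (suc j)

count : ∀ {k} → (Fin k → Bool) → ℕ
count p = NatSum.sum (λ i → if p i then 1 else 0)

count-cong : ∀ {k} {p q : Fin k → Bool} → (∀ i → p i ≡ q i) → count p ≡ count q
count-cong p≡q = NatSum.sum-cong-≗ (λ i → cong (λ b → if b then 1 else 0) (p≡q i))

oddᵇ-count : ∀ {k} (p : Fin k → Bool) → oddᵇ (count p) ≡ ∑[ i < k ] p i
oddᵇ-count {zero} p = refl
oddᵇ-count {suc k} p =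
  trans (oddᵇ-+ (if p zero then 1 else 0) (count (p ∘ suc)))
        (cong₂ _xor_ (oddᵇ-indicator (p zero)) (oddᵇ-count (p ∘ suc)))
  where
  oddᵇ-indicator : ∀ b → oddᵇ (if b then 1 else 0) ≡ b
  oddᵇ-indicator false = refl
  oddᵇ-indicator true = refl

count-complement : ∀ {k} (p : Fin k → Bool) → count p + count (not ∘ p) ≡ k
count-complement {zero} p = refl
count-complement {suc k} p =
  trans (step (p zero) (count (p ∘ suc)) (count (not ∘ p ∘ suc))) (cong suc (count-complement (p ∘ suc)))
  where
  step : ∀ b x y → ((if b then 1 else 0) + x) + ((if not b then 1 else 0) + y) ≡ suc (x + y)
  step false x y = +-suc x y
  step true x y = refl

count-reindex : ∀ {k} (π : Permutation′ k) (p : Fin k → Bool) → count (p ∘ (π ⟨$⟩ʳ_)) ≡ count p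
count-reindex π p = sym (NatSum.∑-permute (λ i → if p i then 1 else 0) π)

-- The sign of a permutation

⟨$⟩ʳ-injective : ∀ {k} (π : Permutation′ k) {i j} → π ⟨$⟩ʳ i ≡ π ⟨$⟩ʳ j → i ≡ j
⟨$⟩ʳ-injective π πi≡πj =
  trans (sym (Permutation.inverseˡ π)) (trans (cong (π ⟨$⟩ˡ_) πi≡πj) (Permutation.inverseˡ π))

module _ {m : ℕ} where

  infix 4 _<ᵇ_
  _<ᵇ_ : Fin m → Fin m → Bool
  i <ᵇ j = does (i <? j)

  <ᵇ-irrefl : ∀ i → (i <ᵇ i) ≡ false
  <ᵇ-irrefl i = dec-false (i <? i) (<-irrefl refl)

  <ᵇ-flip : ∀ {i j} → i ≢ j → (j <ᵇ i) ≡ not (i <ᵇ j)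
  <ᵇ-flip {i} {j} i≢j with <-cmp i j
  ... | tri< i<j _ j≮i = trans (dec-false (j <? i) j≮i) (cong not (sym (dec-true (i <? j) i<j)))
  ... | tri≈ _ i≡j _ = contradiction i≡j i≢j
  ... | tri> i≮j _ j<i = trans (dec-true (j <? i) j<i) (cong not (sym (dec-false (i <? j) i≮j)))

  sign : Permutation′ m → Bool
  sign π = ∑[ i < m ] ∑[ j < m ] ((i <ᵇ j) ∧ (π ⟨$⟩ʳ j <ᵇ π ⟨$⟩ʳ i))

  sign-cong : ∀ (π ρ : Permutation′ m) → (∀ i → π ⟨$⟩ʳ i ≡ ρ ⟨$⟩ʳ i) → sign π ≡ sign ρ
  sign-cong π ρ π≗ρ = ∑∑-cong (λ i j → cong₂ (λ a b → (i <ᵇ j) ∧ (a <ᵇ b)) (π≗ρ j) (π≗ρ i))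

  oddᵇ-inversions : ∀ π → oddᵇ (inversions (π ⟨$⟩ʳ_)) ≡ sign π
  oddᵇ-inversions π = begin
    oddᵇ (inversions (π ⟨$⟩ʳ_))                            ≡⟨ oddᵇ-length-filter inverted? pairs ⟩
    ⊕ˡ inverted pairs                                      ≡⟨ ⊕ˡ-cartesianProduct inverted id (allFin m) ⟩
    ∑[ i < m ] ⊕ˡ (λ j → inverted (i , j)) (tabulate id)
      ≡⟨ sum-cong-≗ (λ i → ⊕ˡ-tabulate (λ j → inverted (i , j)) id) ⟩
    sign π ∎
    where
    open ≡-Reasoning
    pairs : List (Fin m × Fin m)
    pairs = cartesianProduct (allFin m) (allFin m)
    inverted? : Decidable {A = Fin m × Fin m} (λ (i , j) → i Fin.< j × π ⟨$⟩ʳ j Fin.< π ⟨$⟩ʳ i)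
    inverted? (i , j) = (i <? j) ×-dec (π ⟨$⟩ʳ j <? π ⟨$⟩ʳ i)
    inverted : Fin m × Fin m → Bool
    inverted = does ∘ inverted?

  isOddPerm⇒sign≡true : ∀ π → IsOddPerm (π ⟨$⟩ʳ_) → sign π ≡ true
  isOddPerm⇒sign≡true π odd = trans (sym (oddᵇ-inversions π)) (oddᵇ-%2 (inversions (π ⟨$⟩ʳ_)) odd)

  reverses : (Fin m → Fin m) → Fin m → Fin m → Bool
  reverses σ i j = (i <ᵇ j) xor (σ i <ᵇ σ j)

  reverses-diagonal : ∀ σ i → reverses σ i i ≡ false
  reverses-diagonal σ i = cong₂ _xor_ (<ᵇ-irrefl i) (<ᵇ-irrefl (σ i))

  reverses-sym : ∀ (π : Permutation′ m) i j → reverses (π ⟨$⟩ʳ_) i j ≡ reverses (π ⟨$⟩ʳ_) j i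
  reverses-sym π i j with i ≟ j
  ... | yes refl = refl
  ... | no i≢j = begin
    (i <ᵇ j) xor (π ⟨$⟩ʳ i <ᵇ π ⟨$⟩ʳ j)
      ≡⟨ cong₂ _xor_ (<ᵇ-flip (i≢j ∘ sym)) (<ᵇ-flip (i≢j ∘ sym ∘ ⟨$⟩ʳ-injective π)) ⟩
    not (j <ᵇ i) xor not (π ⟨$⟩ʳ j <ᵇ π ⟨$⟩ʳ i)
      ≡⟨ xor-annihilates-not (j <ᵇ i) _ ⟩
    (j <ᵇ i) xor (π ⟨$⟩ʳ j <ᵇ π ⟨$⟩ʳ i) ∎
    where open ≡-Reasoning

  reverses-∘ : ∀ σ τ i j → reverses (σ ∘ τ) i j ≡ reverses τ i j xor reverses σ (τ i) (τ j)
  reverses-∘ σ τ i j = sym (xor-cancel-middle (i <ᵇ j) (τ i <ᵇ τ j) (σ (τ i) <ᵇ σ (τ j)))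

  upperSum : (Fin m → Fin m → Bool) → Bool
  upperSum f = ∑[ i < m ] ∑[ j < m ] ((i <ᵇ j) ∧ f i j)

  upperSum-xor : ∀ f g → upperSum (λ i j → f i j xor g i j) ≡ upperSum f xor upperSum g
  upperSum-xor f g = trans (∑∑-cong (λ i j → ∧-distribˡ-xor (i <ᵇ j) (f i j) (g i j)))
                           (∑∑-distrib-xor (λ i j → (i <ᵇ j) ∧ f i j) (λ i j → (i <ᵇ j) ∧ g i j))

  -- Reindexing replaces the order i < j by π⁻¹ i < π⁻¹ j.  The two differ exactly on
  -- the pairs reversed by π⁻¹, whose contribution is a symmetric sum with zero
  -- diagonal and hence vanishes.
  upperSum-reindex : ∀ (π : Permutation′ m) f → (∀ a b → f a b ≡ f b a) →
                     upperSum (λ i j → f (π ⟨$⟩ʳ i) (π ⟨$⟩ʳ j)) ≡ upperSum f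
  upperSum-reindex π f f-sym = begin
    upperSum (λ i j → f (π ⟨$⟩ʳ i) (π ⟨$⟩ʳ j))
      ≡⟨ ∑∑-cong (λ i j → cong₂ (λ a b → (a <ᵇ b) ∧ f (π ⟨$⟩ʳ i) (π ⟨$⟩ʳ j))
                                 (Permutation.inverseˡ π) (Permutation.inverseˡ π)) ⟨
    ∑[ i < m ] ∑[ j < m ] g (π ⟨$⟩ʳ i) (π ⟨$⟩ʳ j)
      ≡⟨ ∑∑-reindex π g ⟩
    ∑[ a < m ] ∑[ b < m ] g a b
      ≡⟨ ∑∑-cong (λ a b → split (a <ᵇ b) (π ⟨$⟩ˡ a <ᵇ π ⟨$⟩ˡ b) (f a b)) ⟩
    ∑[ a < m ] ∑[ b < m ] (((a <ᵇ b) ∧ f a b) xor (reverses (π ⟨$⟩ˡ_) a b ∧ f a b))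
      ≡⟨ ∑∑-distrib-xor (λ a b → (a <ᵇ b) ∧ f a b) (λ a b → reverses (π ⟨$⟩ˡ_) a b ∧ f a b) ⟩
    upperSum f xor ∑[ a < m ] ∑[ b < m ] (reverses (π ⟨$⟩ˡ_) a b ∧ f a b)
      ≡⟨ cong (upperSum f xor_) reversed-vanishes ⟩
    upperSum f xor false
      ≡⟨ xor-identityʳ (upperSum f) ⟩
    upperSum f ∎
    where
    open ≡-Reasoning
    g : Fin m → Fin m → Bool
    g a b = (π ⟨$⟩ˡ a <ᵇ π ⟨$⟩ˡ b) ∧ f a b
    split : ∀ u v w → v ∧ w ≡ (u ∧ w) xor ((u xor v) ∧ w)
    split false v w = refl
    split true false false = refl
    split true false true = refl
    split true true false = refl
    split true true true = refl
    reversed-vanishes : ∑[ a < m ] ∑[ b < m ] (reverses (π ⟨$⟩ˡ_) a b ∧ f a b) ≡ false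
    reversed-vanishes = begin
      ∑[ a < m ] ∑[ b < m ] (reverses (π ⟨$⟩ˡ_) a b ∧ f a b)
        ≡⟨ ∑∑-symmetric≡trace _ (λ a b → cong₂ _∧_ (reverses-sym (flip π) a b) (f-sym a b)) ⟩
      ∑[ a < m ] (reverses (π ⟨$⟩ˡ_) a a ∧ f a a)
        ≡⟨ sum-cong-≗ (λ a → cong (_∧ f a a) (reverses-diagonal (π ⟨$⟩ˡ_) a)) ⟩
      ∑[ a < m ] false
        ≡⟨ XorSum.sum-replicate-zero m ⟩
      false ∎

  sign≡upperSum-reverses : ∀ π → sign π ≡ upperSum (reverses (π ⟨$⟩ʳ_))
  sign≡upperSum-reverses π = ∑∑-cong pointwise
    where
    pointwise : ∀ i j → (i <ᵇ j) ∧ (π ⟨$⟩ʳ j <ᵇ π ⟨$⟩ʳ i) ≡ (i <ᵇ j) ∧ reverses (π ⟨$⟩ʳ_) i j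
    pointwise i j with i ≟ j
    ... | yes refl rewrite <ᵇ-irrefl i = refl
    ... | no i≢j = trans (cong ((i <ᵇ j) ∧_) (<ᵇ-flip (i≢j ∘ ⟨$⟩ʳ-injective π))) (∧-not≡∧-xor (i <ᵇ j) _)

  sign-∘ₚ : ∀ π ρ → sign (π ∘ₚ ρ) ≡ sign π xor sign ρ
  sign-∘ₚ π ρ = begin
    sign (π ∘ₚ ρ)
      ≡⟨ sign≡upperSum-reverses (π ∘ₚ ρ) ⟩
    upperSum (reverses ((ρ ⟨$⟩ʳ_) ∘ (π ⟨$⟩ʳ_)))
      ≡⟨ ∑∑-cong (λ i j → cong ((i <ᵇ j) ∧_) (reverses-∘ (ρ ⟨$⟩ʳ_) (π ⟨$⟩ʳ_) i j)) ⟩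
    upperSum (λ i j → reverses (π ⟨$⟩ʳ_) i j xor reverses (ρ ⟨$⟩ʳ_) (π ⟨$⟩ʳ i) (π ⟨$⟩ʳ j))
      ≡⟨ upperSum-xor _ _ ⟩
    upperSum (reverses (π ⟨$⟩ʳ_)) xor upperSum (λ i j → reverses (ρ ⟨$⟩ʳ_) (π ⟨$⟩ʳ i) (π ⟨$⟩ʳ j))
      ≡⟨ cong₂ _xor_ (sym (sign≡upperSum-reverses π)) (upperSum-reindex π _ (reverses-sym ρ)) ⟩
    sign π xor upperSum (reverses (ρ ⟨$⟩ʳ_))
      ≡⟨ cong (sign π xor_) (sym (sign≡upperSum-reverses ρ)) ⟩
    sign π xor sign ρ ∎
    where open ≡-Reasoning

  IsInvolution : Permutation′ m → Set
  IsInvolution ρ = ∀ i → ρ ⟨$⟩ʳ (ρ ⟨$⟩ʳ i) ≡ i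

  IsFixedPointFree : Permutation′ m → Set
  IsFixedPointFree ρ = ∀ i → ρ ⟨$⟩ʳ i ≢ i

  -- Substituting j ↦ ρ j makes the summand symmetric in i and j.
  sign-involution : ∀ ρ → IsInvolution ρ → sign ρ ≡ ∑[ i < m ] (i <ᵇ ρ ⟨$⟩ʳ i)
  sign-involution ρ ρ²≡id = begin
    ∑[ i < m ] ∑[ j < m ] ((i <ᵇ j) ∧ (ρ ⟨$⟩ʳ j <ᵇ ρ ⟨$⟩ʳ i))
      ≡⟨ sum-cong-≗ (λ i → ∑-reindex ρ (λ j → (i <ᵇ j) ∧ (ρ ⟨$⟩ʳ j <ᵇ ρ ⟨$⟩ʳ i))) ⟨
    ∑[ i < m ] ∑[ j < m ] ((i <ᵇ ρ ⟨$⟩ʳ j) ∧ (ρ ⟨$⟩ʳ (ρ ⟨$⟩ʳ j) <ᵇ ρ ⟨$⟩ʳ i))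
      ≡⟨ ∑∑-cong (λ i j → cong (λ a → (i <ᵇ ρ ⟨$⟩ʳ j) ∧ (a <ᵇ ρ ⟨$⟩ʳ i)) (ρ²≡id j)) ⟩
    ∑[ i < m ] ∑[ j < m ] ((i <ᵇ ρ ⟨$⟩ʳ j) ∧ (j <ᵇ ρ ⟨$⟩ʳ i))
      ≡⟨ ∑∑-symmetric≡trace _ (λ i j → ∧-comm (i <ᵇ ρ ⟨$⟩ʳ j) (j <ᵇ ρ ⟨$⟩ʳ i)) ⟩
    ∑[ i < m ] ((i <ᵇ ρ ⟨$⟩ʳ i) ∧ (i <ᵇ ρ ⟨$⟩ʳ i))
      ≡⟨ sum-cong-≗ (λ i → ∧-idem (i <ᵇ ρ ⟨$⟩ʳ i)) ⟩
    ∑[ i < m ] (i <ᵇ ρ ⟨$⟩ʳ i) ∎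
    where open ≡-Reasoning

  -- ρ pairs each i with ρ i, and exactly one of the two lies below its partner.
  2*count-below-fixedPointFreeInvolution : ∀ ρ → IsInvolution ρ → IsFixedPointFree ρ →
                                           2 * count (λ i → i <ᵇ ρ ⟨$⟩ʳ i) ≡ m
  2*count-below-fixedPointFreeInvolution ρ ρ²≡id ρi≢i = begin
    2 * count below                                ≡⟨ cong (count below +_) (+-identityʳ (count below)) ⟩
    count below + count below                      ≡⟨ cong (count below +_) above≡below ⟨
    count (λ i → i <ᵇ ρ ⟨$⟩ʳ i) + count above
      ≡⟨ cong (count below +_) (count-cong (λ i → <ᵇ-flip (ρi≢i i ∘ sym))) ⟩
    count below + count (not ∘ below)              ≡⟨ count-complement below ⟩
    m ∎
    where
    open ≡-Reasoning
    below above : Fin m → Bool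
    below i = i <ᵇ ρ ⟨$⟩ʳ i
    above i = ρ ⟨$⟩ʳ i <ᵇ i
    above≡below : count above ≡ count below
    above≡below = trans (sym (count-reindex ρ above)) (count-cong (λ i → cong (_<ᵇ ρ ⟨$⟩ʳ i) (ρ²≡id i)))

  sign-fixedPointFreeInvolution : ∀ ρ ρ′ → IsInvolution ρ → IsFixedPointFree ρ →
                                  IsInvolution ρ′ → IsFixedPointFree ρ′ → sign ρ ≡ sign ρ′
  sign-fixedPointFreeInvolution ρ ρ′ ρ²≡id ρi≢i ρ′²≡id ρ′i≢i = begin
    sign ρ                                   ≡⟨ sign-involution ρ ρ²≡id ⟩
    ∑[ i < m ] (i <ᵇ ρ ⟨$⟩ʳ i)                ≡⟨ oddᵇ-count (λ i → i <ᵇ ρ ⟨$⟩ʳ i) ⟨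
    oddᵇ (count (λ i → i <ᵇ ρ ⟨$⟩ʳ i))        ≡⟨ cong oddᵇ same-count ⟩
    oddᵇ (count (λ i → i <ᵇ ρ′ ⟨$⟩ʳ i))       ≡⟨ oddᵇ-count (λ i → i <ᵇ ρ′ ⟨$⟩ʳ i) ⟩
    ∑[ i < m ] (i <ᵇ ρ′ ⟨$⟩ʳ i)               ≡⟨ sign-involution ρ′ ρ′²≡id ⟨
    sign ρ′ ∎
    where
    open ≡-Reasoning
    same-count : count (λ i → i <ᵇ ρ ⟨$⟩ʳ i) ≡ count (λ i → i <ᵇ ρ′ ⟨$⟩ʳ i)
    same-count = *-cancelˡ-≡ _ _ 2 (trans (2*count-below-fixedPointFreeInvolution ρ ρ²≡id ρi≢i)
                                         (sym (2*count-below-fixedPointFreeInvolution ρ′ ρ′²≡id ρ′i≢i)))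

-- Squares in a finite abelian group

module Squares {n : ℕ} {op : Fin n → Fin n → Fin n} {e : Fin n} {inverse : Fin n → Fin n}
               (isAbelianGroup : IsAbelianGroup _≡_ op e inverse) where

  abelianGroup : AbelianGroup 0ℓ 0ℓ
  abelianGroup = record { isAbelianGroup = isAbelianGroup }

  open AbelianGroup abelianGroup public using (_∙_; ε; _⁻¹)
  open AbelianGroup abelianGroup using (assoc; identityˡ; identityʳ; inverseˡ; group)
  open AbelianGroupProperties abelianGroup using (⁻¹-∙-comm)
  open CommutativeSemigroupProperties (AbelianGroup.commutativeSemigroup abelianGroup) using (interchange)
  open GroupProperties group using (⁻¹-involutive; \\-leftDividesˡ; \\-leftDividesʳ)

  Square : Fin n → Set
  Square a = ∃ λ b → b ∙ b ≡ a

  square? : Decidable Square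
  square? a = any? (λ b → (b ∙ b) ≟ a)

  square-ε : Square ε
  square-ε = ε , identityˡ ε

  square-∙⁺ : ∀ {a b} → Square a → Square b → Square (a ∙ b)
  square-∙⁺ (c , c∙c≡a) (d , d∙d≡b) = c ∙ d , trans (interchange c d c d) (cong₂ _∙_ c∙c≡a d∙d≡b)

  square-⁻¹⁺ : ∀ {a} → Square a → Square (a ⁻¹)
  square-⁻¹⁺ (c , c∙c≡a) = c ⁻¹ , trans (⁻¹-∙-comm c c) (cong _⁻¹ c∙c≡a)

  square-⁻¹⁻ : ∀ {a} → Square (a ⁻¹) → Square a
  square-⁻¹⁻ {a} □a⁻¹ = subst Square (⁻¹-involutive a) (square-⁻¹⁺ □a⁻¹)

  square-∙⁻ : ∀ {a b} → Square a → Square (a ∙ b) → Square b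
  square-∙⁻ {a} {b} □a □ab = subst Square (\\-leftDividesʳ a b) (square-∙⁺ (square-⁻¹⁺ □a) □ab)

  translation : Fin n → Permutation′ n
  translation c = permutation (c ∙_) (c ⁻¹ ∙_) (\\-leftDividesˡ c) (\\-leftDividesʳ c)

  reflect : Fin n → Fin n → Fin n
  reflect c a = c ∙ a ⁻¹

  reflect-involutive : ∀ c a → reflect c (reflect c a) ≡ a
  reflect-involutive c a = begin
    c ∙ (c ∙ a ⁻¹) ⁻¹     ≡⟨ cong (c ∙_) (⁻¹-∙-comm c (a ⁻¹)) ⟨
    c ∙ (c ⁻¹ ∙ a ⁻¹ ⁻¹)  ≡⟨ \\-leftDividesˡ c (a ⁻¹ ⁻¹) ⟩
    a ⁻¹ ⁻¹               ≡⟨ ⁻¹-involutive a ⟩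
    a ∎
    where open ≡-Reasoning

  reflection : Fin n → Permutation′ n
  reflection c = permutation (reflect c) (reflect c) (reflect-involutive c) (reflect-involutive c)

  reflection-fixedPointFree : ∀ {c} → ¬ Square c → IsFixedPointFree (reflection c)
  reflection-fixedPointFree {c} ¬□c a c∙a⁻¹≡a = ¬□c (a , (begin
    a ∙ a               ≡⟨ cong (_∙ a) c∙a⁻¹≡a ⟨
    (c ∙ a ⁻¹) ∙ a      ≡⟨ assoc c (a ⁻¹) a ⟩
    c ∙ (a ⁻¹ ∙ a)      ≡⟨ cong (c ∙_) (inverseˡ a) ⟩
    c ∙ ε               ≡⟨ identityʳ c ⟩
    c ∎))
    where open ≡-Reasoning

  sign-translation-∙ : ∀ p q → sign (translation (p ∙ q)) ≡ sign (translation q) xor sign (translation p)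
  sign-translation-∙ p q = trans (sign-cong (translation (p ∙ q)) (translation q ∘ₚ translation p) (assoc p q))
                                 (sign-∘ₚ (translation q) (translation p))

  sign-translation-square : ∀ b → sign (translation (b ∙ b)) ≡ false
  sign-translation-square b = trans (sign-translation-∙ b b) (xor-same (sign (translation b)))

  sign-translation-reflection : ∀ c → sign (translation c) ≡ sign (reflection ε) xor sign (reflection c)
  sign-translation-reflection c =
    trans (sign-cong (translation c) (reflection ε ∘ₚ reflection c) c∙a≡reflect-reflect)
          (sign-∘ₚ (reflection ε) (reflection c))
    where
    c∙a≡reflect-reflect : ∀ a → c ∙ a ≡ reflect c (reflect ε a)
    c∙a≡reflect-reflect a = cong (c ∙_) (sym (trans (cong _⁻¹ (identityˡ (a ⁻¹))) (⁻¹-involutive a)))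

  sign-translation-nonSquare : ∀ {c d} → ¬ Square c → ¬ Square d → sign (translation c) ≡ sign (translation d)
  sign-translation-nonSquare {c} {d} ¬□c ¬□d = begin
    sign (translation c)                             ≡⟨ sign-translation-reflection c ⟩
    sign (reflection ε) xor sign (reflection c)      ≡⟨ cong (sign (reflection ε) xor_) same-reflection-sign ⟩
    sign (reflection ε) xor sign (reflection d)      ≡⟨ sign-translation-reflection d ⟨
    sign (translation d) ∎
    where
    open ≡-Reasoning
    same-reflection-sign : sign (reflection c) ≡ sign (reflection d)
    same-reflection-sign = sign-fixedPointFreeInvolution (reflection c) (reflection d)
      (reflect-involutive c) (reflection-fixedPointFree ¬□c) (reflect-involutive d) (reflection-fixedPointFree ¬□d)

  odd-translation⇒nonSquare-∙-nonSquare : ∀ {a} → sign (translation a) ≡ true →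
                                          ∀ {p q} → ¬ Square p → ¬ Square q → Square (p ∙ q)
  odd-translation⇒nonSquare-∙-nonSquare {a} odd {p} {q} ¬□p ¬□q = decidable-stable (square? (p ∙ q)) ¬¬□pq
    where
    ¬□a : ¬ Square a
    ¬□a (b , b∙b≡a) = not-¬ (trans (cong (sign ∘ translation) (sym b∙b≡a)) (sign-translation-square b)) odd
    odd-nonSquare : ∀ {c} → ¬ Square c → sign (translation c) ≡ true
    odd-nonSquare ¬□c = trans (sign-translation-nonSquare ¬□c ¬□a) odd
    ¬¬□pq : ¬ ¬ Square (p ∙ q)
    ¬¬□pq ¬□pq = not-¬ (trans (sign-translation-∙ p q) (cong₂ _xor_ (odd-nonSquare ¬□q) (odd-nonSquare ¬□p)))
                       (odd-nonSquare ¬□pq)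

-- The generalized dihedral group

module DihedralGroup {n : ℕ} {op : Fin n → Fin n → Fin n} {e : Fin n} {inverse : Fin n → Fin n}
                     (isAbelianGroup : IsAbelianGroup _≡_ op e inverse) where

  open Squares isAbelianGroup
  open AbelianGroup abelianGroup using (assoc; comm; identityˡ; identityʳ; inverseˡ; inverseʳ; group)
  open AbelianGroupProperties abelianGroup using (⁻¹-∙-comm)
  open GroupProperties group using (⁻¹-involutive; ε⁻¹≈ε; identityʳ-unique)
  open Dihedral _∙_ ε _⁻¹ public

  ·-assoc : ∀ g h k → (g · h) · k ≡ g · (h · k)
  ·-assoc (s , a) (false , b) (false , c) = cong₂ _,_ (xor-assoc s false false) (assoc a b c)
  ·-assoc (s , a) (true , b) (false , c) = cong₂ _,_ (xor-assoc s true false) (assoc (a ⁻¹) b c)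
  ·-assoc (s , a) (false , b) (true , c) = cong₂ _,_ (xor-assoc s false true) (begin
    (a ∙ b) ⁻¹ ∙ c          ≡⟨ cong (_∙ c) (⁻¹-∙-comm a b) ⟨
    (a ⁻¹ ∙ b ⁻¹) ∙ c       ≡⟨ assoc (a ⁻¹) (b ⁻¹) c ⟩
    a ⁻¹ ∙ (b ⁻¹ ∙ c) ∎)
    where open ≡-Reasoning
  ·-assoc (s , a) (true , b) (true , c) = cong₂ _,_ (xor-assoc s true true) (begin
    (a ⁻¹ ∙ b) ⁻¹ ∙ c       ≡⟨ cong (_∙ c) (⁻¹-∙-comm (a ⁻¹) b) ⟨
    (a ⁻¹ ⁻¹ ∙ b ⁻¹) ∙ c    ≡⟨ cong (λ y → y ∙ b ⁻¹ ∙ c) (⁻¹-involutive a) ⟩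
    (a ∙ b ⁻¹) ∙ c          ≡⟨ assoc a (b ⁻¹) c ⟩
    a ∙ (b ⁻¹ ∙ c) ∎)
    where open ≡-Reasoning

  ·-identityˡ : ∀ g → 1G · g ≡ g
  ·-identityˡ (false , a) = cong (false ,_) (identityˡ a)
  ·-identityˡ (true , a) = cong (true ,_) (trans (cong (_∙ a) ε⁻¹≈ε) (identityˡ a))

  ·-identityʳ : ∀ g → g · 1G ≡ g
  ·-identityʳ (s , a) = cong₂ _,_ (xor-identityʳ s) (identityʳ a)

  ·-inverseˡ : ∀ g → inv g · g ≡ 1G
  ·-inverseˡ (false , a) = cong (false ,_) (inverseˡ a)
  ·-inverseˡ (true , a) = cong (false ,_) (inverseˡ a)

  ·-inverseʳ : ∀ g → g · inv g ≡ 1G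
  ·-inverseʳ (false , a) = cong (false ,_) (inverseʳ a)
  ·-inverseʳ (true , a) = cong (false ,_) (inverseˡ a)

  dihedralGroup : Group 0ℓ 0ℓ
  dihedralGroup = record
    { isGroup = record
      { isMonoid = record
        { isSemigroup = record
          { isMagma = record { isEquivalence = isEquivalence ; ∙-cong = cong₂ _·_ }
          ; assoc = ·-assoc }
        ; identity = ·-identityˡ , ·-identityʳ }
      ; inverse = ·-inverseˡ , ·-inverseʳ
      ; ⁻¹-cong = cong inv } }

  open Group dihedralGroup using (_\\_)
  module D = GroupProperties dihedralGroup

  \\-translate : ∀ g u v → (g · u) \\ (g · v) ≡ u \\ v
  \\-translate g u v = begin
    inv (g · u) · (g · v)        ≡⟨ cong (_· (g · v)) (D.⁻¹-anti-homo-∙ g u) ⟩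
    (inv u · inv g) · (g · v)    ≡⟨ ·-assoc (inv u) (inv g) (g · v) ⟩
    inv u · (inv g · (g · v))    ≡⟨ cong (inv u ·_) (D.\\-leftDividesʳ g v) ⟩
    inv u · v ∎
    where open ≡-Reasoning

  \\≡1G⇒≡ : ∀ {g h} → g \\ h ≡ 1G → g ≡ h
  \\≡1G⇒≡ {g} {h} g\\h≡1G = trans (sym (·-identityʳ g)) (trans (cong (g ·_) (sym g\\h≡1G)) (D.\\-leftDividesˡ g h))

  1G-\\ : ∀ g → 1G \\ g ≡ g
  1G-\\ g = trans (cong (_· g) D.ε⁻¹≈ε) (·-identityˡ g)

  bit-\\ : ∀ u v → proj₁ (u \\ v) ≡ proj₁ u xor proj₁ v
  bit-\\ (false , a) v = refl
  bit-\\ (true , a) v = refl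

  bits≡⇒rotation : ∀ {u v} → proj₁ u ≡ proj₁ v → proj₁ (u \\ v) ≡ false
  bits≡⇒rotation {u} {v} u₁≡v₁ = trans (bit-\\ u v) (trans (cong (proj₁ u xor_) (sym u₁≡v₁)) (xor-same (proj₁ u)))

  rotation≢reflection : ∀ {g h : G} → proj₁ g ≡ false → proj₁ h ≡ true → g ≢ h
  rotation≢reflection g-rotation h-reflection g≡h = not-¬ g-rotation (trans (cong proj₁ g≡h) h-reflection)

  reflection·rotation : ∀ {p q} → proj₁ p ≡ false → proj₁ q ≡ true → q · p ≡ p \\ q
  reflection·rotation {false , a} {true , b} refl refl =
    cong (true ,_) (trans (comm b a) (cong (_∙ b) (sym (⁻¹-involutive a))))

  ¬derangement-1G : ¬ Derangement 1G
  ¬derangement-1G der = der 1G (1G , inj₁ refl , refl)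

  ¬derangement-squareReflection : ∀ {a} → Square a → ¬ Derangement (true , a)
  ¬derangement-squareReflection {a} (c , c∙c≡a) der = der (false , c ⁻¹) (x , inj₂ refl , cong (true ,_) (begin
    a ∙ c ⁻¹           ≡⟨ cong (_∙ c ⁻¹) c∙c≡a ⟨
    (c ∙ c) ∙ c ⁻¹     ≡⟨ assoc c c (c ⁻¹) ⟩
    c ∙ (c ∙ c ⁻¹)     ≡⟨ cong (c ∙_) (inverseʳ c) ⟩
    c ∙ ε              ≡⟨ cong (_∙ ε) (⁻¹-involutive c) ⟨
    c ⁻¹ ⁻¹ ∙ ε ∎))
    where open ≡-Reasoning

  absorbed : ∀ {a b} → a ∙ b ≡ b ∙ ε → a ≡ ε
  absorbed {a} {b} a∙b≡b∙ε = identityʳ-unique b a (trans (comm b a) (trans a∙b≡b∙ε (identityʳ b)))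

  derangement-rotation : ∀ {a} → a ≢ ε → Derangement (false , a)
  derangement-rotation a≢ε (false , b) (_ , inj₁ refl , a∙b≡b∙ε) = a≢ε (absorbed (cong proj₂ a∙b≡b∙ε))
  derangement-rotation {a} a≢ε (true , b) (_ , inj₁ refl , a⁻¹∙b≡b∙ε) = a≢ε (begin
    a              ≡⟨ ⁻¹-involutive a ⟨
    a ⁻¹ ⁻¹        ≡⟨ cong _⁻¹ (absorbed (cong proj₂ a⁻¹∙b≡b∙ε)) ⟩
    ε ⁻¹           ≡⟨ ε⁻¹≈ε ⟩
    ε ∎)
    where open ≡-Reasoning
  derangement-rotation a≢ε (false , b) (_ , inj₂ refl , ())
  derangement-rotation a≢ε (true , b) (_ , inj₂ refl , ())

  ¬derangement⇒1G⊎reflection : ∀ {d} → ¬ Derangement d → d ≡ 1G ⊎ proj₁ d ≡ true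
  ¬derangement⇒1G⊎reflection {false , a} ¬der with a ≟ ε
  ... | yes a≡ε = inj₁ (cong (false ,_) a≡ε)
  ... | no a≢ε = contradiction (derangement-rotation a≢ε) ¬der
  ¬derangement⇒1G⊎reflection {true , a} ¬der = inj₂ refl

  -- If g⁻¹ k = k h with h ∈ H, then g (k h) = k = (k h) h⁻¹.
  derangement-inverseClosed : InverseClosed Derangement
  derangement-inverseClosed g der k (h , h∈H , g⁻¹k≡kh) = der (k · h) (inv h , inv-∈H h∈H , (begin
    g · (k · h)          ≡⟨ cong (g ·_) g⁻¹k≡kh ⟨
    g · (inv g · k)      ≡⟨ D.\\-leftDividesˡ g k ⟩
    k                    ≡⟨ D.//-rightDividesʳ h k ⟨
    (k · h) · inv h ∎))
    where
    open ≡-Reasoning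
    inv-∈H : ∀ {h} → InH h → InH (inv h)
    inv-∈H (inj₁ refl) = inj₁ (cong (false ,_) ε⁻¹≈ε)
    inv-∈H (inj₂ refl) = inj₂ refl

  NonAdjacent : (G → Set) → G → G → Set
  NonAdjacent S g h = g ≢ h × ¬ S (g \\ h)

  module _ {S : G → Set} where

    independent⇒allPairs : ∀ {I} → Independent S I → AllPairs (NonAdjacent S) I
    independent⇒allPairs {[]} _ = []
    independent⇒allPairs {g ∷ I} (g∉I ∷ unique , ¬S) =
      All.zip (g∉I , All.tabulate (λ h∈I → ¬S g _ (here refl) (there h∈I)))
      ∷ independent⇒allPairs (unique , λ u v u∈I v∈I → ¬S u v (there u∈I) (there v∈I))

    allPairs-translate : ∀ g {I} → AllPairs (NonAdjacent S) I → AllPairs (NonAdjacent S) (map (g ·_) I)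
    allPairs-translate g = AllPairs.map⁺ ∘ AllPairs.map λ {u} {v} (u≢v , ¬Su\\v) →
      u≢v ∘ D.∙-cancelˡ g u v , ¬Su\\v ∘ subst S (\\-translate g u v)

    module _ (S-inverseClosed : InverseClosed S) where

      nonAdjacent-sym : ∀ {g h} → NonAdjacent S g h → NonAdjacent S h g
      nonAdjacent-sym {g} {h} (g≢h , ¬Sg\\h) =
        g≢h ∘ sym , ¬Sg\\h ∘ subst S (D.⁻¹-anti-homo-\\ h g) ∘ S-inverseClosed (h \\ g)

      allPairs⇒independent : ¬ S 1G → ∀ {I} → AllPairs (NonAdjacent S) I → Independent S I
      allPairs⇒independent ¬S1G nonAdjacent = AllPairs.map proj₁ nonAdjacent , λ _ _ → pairwise nonAdjacent
        where
        pairwise : ∀ {g h I} → AllPairs (NonAdjacent S) I → g ∈ I → h ∈ I → ¬ S (g \\ h)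
        pairwise {g} _ (here refl) (here refl) = ¬S1G ∘ subst S (·-inverseˡ g)
        pairwise (g~I ∷ _) (here refl) (there h∈I) = proj₂ (All.lookup g~I h∈I)
        pairwise (h~I ∷ _) (there g∈I) (here refl) = proj₂ (nonAdjacent-sym (All.lookup h~I g∈I))
        pairwise (_ ∷ I~I) (there g∈I) (there h∈I) = pairwise I~I g∈I h∈I

  Γ-allPairs-1G-x : AllPairs (NonAdjacent Derangement) (1G ∷ x ∷ [])
  Γ-allPairs-1G-x =
    (((λ ()) , ¬derangement-squareReflection square-ε ∘ subst Derangement (1G-\\ x)) ∷ []) ∷ [] ∷ []

  Γ-nonAdjacent⇒bits-differ : ∀ {g h} → NonAdjacent Derangement g h → proj₁ g ≢ proj₁ h
  Γ-nonAdjacent⇒bits-differ {g} {h} (g≢h , ¬der) g₁≡h₁ with ¬derangement⇒1G⊎reflection ¬der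
  ... | inj₁ g\\h≡1G = g≢h (\\≡1G⇒≡ g\\h≡1G)
  ... | inj₂ g\\h-reflection = not-¬ (bits≡⇒rotation {g} {h} g₁≡h₁) g\\h-reflection

  Γ-no-triangle : ∀ {g₁ g₂ g₃} → NonAdjacent Derangement g₁ g₂ → NonAdjacent Derangement g₁ g₃ →
                  ¬ NonAdjacent Derangement g₂ g₃
  Γ-no-triangle n₁₂ n₁₃ n₂₃ =
    Γ-nonAdjacent⇒bits-differ n₂₃ (≢-≢⇒≡ (Γ-nonAdjacent⇒bits-differ n₁₂) (Γ-nonAdjacent⇒bits-differ n₁₃))

  Γ-independent-length≤2 : ∀ {I} → AllPairs (NonAdjacent Derangement) I → length I ≤ 2
  Γ-independent-length≤2 [] = z≤n
  Γ-independent-length≤2 ([] ∷ []) = s≤s z≤n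
  Γ-independent-length≤2 ((_ ∷ []) ∷ [] ∷ []) = s≤s (s≤s z≤n)
  Γ-independent-length≤2 ((n₁₂ ∷ n₁₃ ∷ _) ∷ (n₂₃ ∷ _) ∷ _) = contradiction n₂₃ (Γ-no-triangle n₁₂ n₁₃)

  module Extension (nonSquare-∙-nonSquare : ∀ {p q} → ¬ Square p → ¬ Square q → Square (p ∙ q))
                   {C : G → Set} (C-inverseClosed : InverseClosed C)
                   (C⊆derangement : ∀ g → C g → Derangement g) where

    nonSquareᵇ : Fin n → Bool
    nonSquareᵇ a = not (does (square? a))

    nonSquareᵇ≡false⇒square : ∀ {a} → nonSquareᵇ a ≡ false → Square a
    nonSquareᵇ≡false⇒square {a} with square? a
    ... | yes □a = λ _ → □a
    ... | no _ = λ ()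

    nonSquareᵇ-∙ : ∀ a b → nonSquareᵇ (a ∙ b) ≡ nonSquareᵇ a xor nonSquareᵇ b
    nonSquareᵇ-∙ a b with square? a | square? b | square? (a ∙ b)
    ... | yes _  | yes _  | yes _ = refl
    ... | yes □a | yes □b | no ¬□ab = contradiction (square-∙⁺ □a □b) ¬□ab
    ... | yes □a | no ¬□b | yes □ab = contradiction (square-∙⁻ □a □ab) ¬□b
    ... | yes _  | no _   | no _ = refl
    ... | no ¬□a | yes □b | yes □ab = contradiction (square-∙⁻ □b (subst Square (comm a b) □ab)) ¬□a
    ... | no _   | yes _  | no _ = refl
    ... | no _   | no _   | yes _ = refl
    ... | no ¬□a | no ¬□b | no ¬□ab = contradiction (nonSquare-∙-nonSquare ¬□a ¬□b) ¬□ab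

    nonSquareᵇ-⁻¹ : ∀ a → nonSquareᵇ (a ⁻¹) ≡ nonSquareᵇ a
    nonSquareᵇ-⁻¹ a with square? a | square? (a ⁻¹)
    ... | yes _  | yes _ = refl
    ... | no _   | no _ = refl
    ... | yes □a | no ¬□a⁻¹ = contradiction (square-⁻¹⁺ □a) ¬□a⁻¹
    ... | no ¬□a | yes □a⁻¹ = contradiction (square-⁻¹⁻ □a⁻¹) ¬□a

    class : G → Bool × Bool
    class (s , a) = s , nonSquareᵇ a

    _⊕_ : Bool × Bool → Bool × Bool → Bool × Bool
    (s , a) ⊕ (t , b) = s xor t , a xor b

    ⊕-cancelˡ : ∀ u v → u ⊕ (u ⊕ v) ≡ v
    ⊕-cancelˡ (s , a) (t , b) = cong₂ _,_ (xor-cancelˡ s t) (xor-cancelˡ a b)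

    class-· : ∀ u v → class (u · v) ≡ class u ⊕ class v
    class-· (s , a) (t , b) =
      cong (s xor t ,_) (trans (nonSquareᵇ-∙ _ b) (cong (_xor nonSquareᵇ b) (nonSquareᵇ-if t)))
      where
      nonSquareᵇ-if : ∀ t → nonSquareᵇ (if t then a ⁻¹ else a) ≡ nonSquareᵇ a
      nonSquareᵇ-if false = refl
      nonSquareᵇ-if true = nonSquareᵇ-⁻¹ a

    class-inv : ∀ u → class (inv u) ≡ class u
    class-inv (false , a) = cong (false ,_) (nonSquareᵇ-⁻¹ a)
    class-inv (true , a) = refl

    class-\\ : ∀ u v → class (u \\ v) ≡ class u ⊕ class v
    class-\\ u v = trans (class-· (inv u) v) (cong (_⊕ class v) (class-inv u))

    class-\\-\\ : ∀ g h k → class (h \\ k) ≡ class (g \\ h) ⊕ class (g \\ k)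
    class-\\-\\ g h k = trans (cong class (sym (\\-translate (inv g) h k))) (class-\\ (g \\ h) (g \\ k))

    class-x : class x ≡ (true , false)
    class-x with square? ε
    ... | yes _ = refl
    ... | no ¬□ε = contradiction square-ε ¬□ε

    ¬C-1G : ¬ C 1G
    ¬C-1G = ¬derangement-1G ∘ C⊆derangement 1G

    ¬C-squareReflection : ∀ {d} → class d ≡ (true , false) → ¬ C d
    ¬C-squareReflection {true , a} d∈xK =
      ¬derangement-squareReflection (nonSquareᵇ≡false⇒square (cong proj₂ d∈xK)) ∘ C⊆derangement _

    -- Since q p = p⁻¹ q, the pairs (1, q p) and (p, q) have the same difference, as
    -- do (1, p) and (q, q p); the pairs (1, q) and (p, q p) differ by elements of x K.
    parallelogram : ∀ {p q} → proj₁ p ≡ false → p ≢ 1G → class q ≡ (true , false) → ¬ C p → ¬ C (p \\ q) →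
                    AllPairs (NonAdjacent C) (1G ∷ p ∷ q ∷ q · p ∷ [])
    parallelogram {p} {q} p-rotation p≢1G q∈xK ¬Cp ¬Cp\\q =
        ( (p≢1G ∘ sym , ¬Cp ∘ subst C (1G-\\ p))
        ∷ (rotation≢reflection refl q-reflection , ¬C-squareReflection q∈xK ∘ subst C (1G-\\ q))
        ∷ (rotation≢reflection refl qp-reflection , ¬Cp\\q ∘ subst C (trans (1G-\\ (q · p)) q·p≡p\\q))
        ∷ [])
      ∷ ( (rotation≢reflection p-rotation q-reflection , ¬Cp\\q)
        ∷ (rotation≢reflection p-rotation qp-reflection , ¬C-squareReflection p\\qp∈xK)
        ∷ [])
      ∷ ((q≢q·p , ¬Cp ∘ subst C (D.\\-leftDividesʳ q p)) ∷ [])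
      ∷ []
      ∷ []
      where
      open ≡-Reasoning
      q-reflection : proj₁ q ≡ true
      q-reflection = cong proj₁ q∈xK
      qp-reflection : proj₁ (q · p) ≡ true
      qp-reflection = cong₂ _xor_ q-reflection p-rotation
      q·p≡p\\q : q · p ≡ p \\ q
      q·p≡p\\q = reflection·rotation p-rotation q-reflection
      q≢q·p : q ≢ q · p
      q≢q·p q≡q·p = p≢1G (D.identityʳ-unique q p (sym q≡q·p))
      p\\qp∈xK : class (p \\ (q · p)) ≡ (true , false)
      p\\qp∈xK = begin
        class (p \\ (q · p))             ≡⟨ cong (class ∘ (p \\_)) q·p≡p\\q ⟩
        class (p \\ (p \\ q))            ≡⟨ class-\\ p (p \\ q) ⟩
        class p ⊕ class (p \\ q)         ≡⟨ cong (class p ⊕_) (class-\\ p q) ⟩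
        class p ⊕ (class p ⊕ class q)    ≡⟨ ⊕-cancelˡ (class p) (class q) ⟩
        class q                          ≡⟨ q∈xK ⟩
        (true , false) ∎

    IndependentOfSize4 : Set
    IndependentOfSize4 = ∃ λ I → Independent C I × length I ≡ 4

    extend-parallelogram : ∀ g {p q} → proj₁ p ≡ false → p ≢ 1G → class q ≡ (true , false) →
                           ¬ C p → ¬ C (p \\ q) → IndependentOfSize4
    extend-parallelogram g p-rotation p≢1G q∈xK ¬Cp ¬Cp\\q =
      _ , allPairs⇒independent C-inverseClosed ¬C-1G
            (allPairs-translate {S = C} g (parallelogram p-rotation p≢1G q∈xK ¬Cp ¬Cp\\q)) , refl

    extend-square : ∀ {g h} → NonAdjacent C g h → class (g \\ h) ≡ (false , false) → IndependentOfSize4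
    extend-square {g} {h} (g≢h , ¬Cg\\h) g\\h∈K =
      extend-parallelogram g (cong proj₁ g\\h∈K) (g≢h ∘ \\≡1G⇒≡) class-x ¬Cg\\h
        (¬C-squareReflection (trans (class-\\ (g \\ h) x) (cong₂ _⊕_ g\\h∈K class-x)))

    extend-pivot : ∀ {g h k} → NonAdjacent C g h → NonAdjacent C h k →
                   proj₁ (g \\ h) ≡ false → class (g \\ k) ≡ (true , false) → IndependentOfSize4
    extend-pivot {g} {h} {k} (g≢h , ¬Cg\\h) (_ , ¬Ch\\k) g\\h-rotation g\\k∈xK =
      extend-parallelogram g g\\h-rotation (g≢h ∘ \\≡1G⇒≡) g\\k∈xK ¬Cg\\h
        (¬Ch\\k ∘ subst C (\\-translate (inv g) h k))

    -- Depending on the classes of g⁻¹h and g⁻¹k, either some pair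
    -- differs by a non-trivial element of K, or g or h sees the other two points
    -- through a rotation and an element of x K.
    extend-sameBit : ∀ {g h k} → proj₁ g ≡ proj₁ h →
                     NonAdjacent C g h → NonAdjacent C g k → NonAdjacent C h k → IndependentOfSize4
    extend-sameBit {g} {h} {k} g₁≡h₁ gh gk hk with class (g \\ h) in gh-class | class (g \\ k) in gk-class
    ... | true , _ | _ = contradiction (cong proj₁ gh-class) (not-¬ (bits≡⇒rotation {g} {h} g₁≡h₁))
    ... | false , false | _ = extend-square gh gh-class
    ... | false , true | false , false = extend-square gk gk-class
    ... | false , true | false , true = extend-square hk (trans (class-\\-\\ g h k) (cong₂ _⊕_ gh-class gk-class))
    ... | false , true | true , false = extend-pivot gh hk (cong proj₁ gh-class) gk-class
    ... | false , true | true , true =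
      extend-pivot (nonAdjacent-sym C-inverseClosed gh) gk (bits≡⇒rotation {h} {g} (sym g₁≡h₁))
                   (trans (class-\\-\\ g h k) (cong₂ _⊕_ gh-class gk-class))

    extend-triangle : ∀ {g₁ g₂ g₃} → NonAdjacent C g₁ g₂ → NonAdjacent C g₁ g₃ → NonAdjacent C g₂ g₃ →
                      IndependentOfSize4
    extend-triangle {g₁} {g₂} {g₃} n₁₂ n₁₃ n₂₃ with proj₁ g₁ Bool.≟ proj₁ g₂ | proj₁ g₁ Bool.≟ proj₁ g₃
    ... | yes b₁≡b₂ | _ = extend-sameBit b₁≡b₂ n₁₂ n₁₃ n₂₃
    ... | no _ | yes b₁≡b₃ = extend-sameBit b₁≡b₃ n₁₃ n₁₂ (nonAdjacent-sym C-inverseClosed n₂₃)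
    ... | no b₁≢b₂ | no b₁≢b₃ = extend-sameBit (≢-≢⇒≡ b₁≢b₂ b₁≢b₃) n₂₃
                                   (nonAdjacent-sym C-inverseClosed n₁₂) (nonAdjacent-sym C-inverseClosed n₁₃)

    extend-independent : ∀ {I} → Independent C I → 3 ≤ length I → IndependentOfSize4
    extend-independent I-independent = extend (independent⇒allPairs {S = C} I-independent)
      where
      extend : ∀ {I} → AllPairs (NonAdjacent C) I → 3 ≤ length I → IndependentOfSize4
      extend ((n₁₂ ∷ n₁₃ ∷ _) ∷ (n₂₃ ∷ _) ∷ _) _ = extend-triangle n₁₂ n₁₃ n₂₃
      extend ([] ∷ []) (s≤s ())
      extend ((_ ∷ []) ∷ [] ∷ []) (s≤s (s≤s ()))

-- The argument does not use 2 ∣ n or an element of order greater than two.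
corollary4p9 : (n : ℕ) (_∙_ : Fin n → Fin n → Fin n) (ε : Fin n) (_⁻¹ : Fin n → Fin n)
    → IsAbelianGroup _≡_ _∙_ ε _⁻¹
    → 2 ∣ n
    → (∃ λ a → a ∙ a ≢ ε)
    → (∃ λ a → IsOddPerm (Dihedral.cosetAction _∙_ ε _⁻¹ (false , a)))
    → (C : Dihedral.G _∙_ ε _⁻¹ → Set)
    → Dihedral.InverseClosed _∙_ ε _⁻¹ C
    → (∀ g → C g → Dihedral.Derangement _∙_ ε _⁻¹ g)
    → (αΓ αC : ℕ)
    → Dihedral.IsIndependenceNumber _∙_ ε _⁻¹ (Dihedral.Derangement _∙_ ε _⁻¹) αΓ
    → Dihedral.IsIndependenceNumber _∙_ ε _⁻¹ C αC
    → αΓ < αC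
    → αC < 2 * αΓ
    → ⊥
corollary4p9 n _∙_ ε _⁻¹ isAbelianGroup _ _ (a , a-odd) C C-inverseClosed C⊆derangement _ _
  ((IΓ , IΓ-independent , refl) , αΓ-maximal) ((IC , IC-independent , refl) , αC-maximal) αΓ<αC αC<2αΓ =
  ≤⇒≯ 4≤αC αC<4
  where
  open Squares isAbelianGroup using (translation; odd-translation⇒nonSquare-∙-nonSquare)
  open DihedralGroup isAbelianGroup
  open Extension (odd-translation⇒nonSquare-∙-nonSquare (isOddPerm⇒sign≡true (translation a) a-odd))
                 C-inverseClosed C⊆derangement
  αΓ≤2 : length IΓ ≤ 2
  αΓ≤2 = Γ-independent-length≤2 (independent⇒allPairs {S = Derangement} IΓ-independent)
  2≤αΓ : 2 ≤ length IΓ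
  2≤αΓ = αΓ-maximal _ (allPairs⇒independent derangement-inverseClosed ¬derangement-1G Γ-allPairs-1G-x)
  4≤αC : 4 ≤ length IC
  4≤αC with extend-independent IC-independent (≤-trans (s≤s 2≤αΓ) αΓ<αC)
  ... | I , I-independent , |I|≡4 = subst (_≤ length IC) |I|≡4 (αC-maximal I I-independent)
  αC<4 : length IC < 4
  αC<4 = <-≤-trans αC<2αΓ (*-monoʳ-≤ 2 αΓ≤2)
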